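{- Let $\mathcal{T}$ be a collection of binary phylogenetic $X$-trees and $S$ a partial tree-child cherry picking sequence such that at least one tree in $\mathcal{T}/S$ has more than one leaf. Then every optimal solution of $(\mathcal{T},S)$ is an extension of some sequence $S\circ\langle (x,y)\rangle$ where $\{x,y\}$ is a cherry of at least one tree in $\mathcal{T}/S$.
   Context: A binary phylogenetic $X'$-tree is a rooted tree whose root has out-degree 2, whose internal non-root nodes have in-degree 1 and out-degree 2, and whose leaves are bijectively labelled by $X'$ (or a single node if $|X'|=1$). A pair $\{x,y\}$ is a cherry of a tree if leaves $x,y$ are siblings. A cherry picking sequence is a sequence $S=\langle (x_1,y_1),\dots,(x_r,y_r),(x_{r+1},-),\dots,(x_s,-)\rangle$ with $x_i,y_i\in X$; $|S|=s$; it is partial if $s=r$; it is tree-child if $s\le r+1$ and $y_j\ne x_i$ for all $1\le i<j\le s$. $\circ$ denotes concatenation; $S\circ S'$ is an extension of $S$. Applying $S$ to a tree $T$: $T^{(0)}=T$, and for $j\le r$, if $\{x_j,y_j\}$ is a cherry of $T^{(j-1)}$ then $T^{(j)}$ is obtained by deleting leaf $x_j$ and suppressing the parent of $y_j$, otherwise $T^{(j)}=T^{(j-1)}$; $T/S=T^{(r)}$, $\mathcal{T}/S=\{T/S:T\in\mathcal{T}\}$. $S$ is a cherry picking sequence for $\mathcal{T}$ if $s>r$, $\{x_1,\dots,x_s\}=X$, and each $T/S$ ($T\in\mathcal{T}$) is a single leaf in $\{x_{r+1},\dots,x_s\}$. A solution of $(\mathcal{T},S)$ is a sequence $S\circ S'$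 that is a cherry picking sequence for $\mathcal{T}$; it is optimal if no solution of $(\mathcal{T},S)$ is shorter. -}

module Defs where

open import Data.Nat using (ℕ; _≟_; _<_; _≤_)
open import Data.Bool using (Bool; true; false; if_then_else_; _∧_; _∨_)
open import Data.List using (List; []; _∷_; _++_; [_]; length; map)
open import Data.List.Relation.Unary.All using (All)
open import Data.List.Relation.Unary.Any using (Any)
open import Data.List.Relation.Unary.Unique.Propositional using (Unique)
open import Data.List.Membership.Propositional using (_∈_)
open import Data.List.Relation.Binary.Permutation.Propositional using (_↭_)
open import Data.Product using (Σ; ∃; ∃-syntax; _×_; _,_)
open import Data.Sum using (_⊎_)
open import Data.Unit using (⊤)
open import Data.Empty using (⊥)
open import Relation.Nullary using (¬_)
open import Relation.Nullary.Decidable using (⌊_⌋)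
open import Relation.Binary.PropositionalEquality using (_≡_; _≢_)
open import Function.Bundles using (_⇔_)

-- Rooted binary trees with leaves labelled by naturals.
-- A node has exactly two children (root out-degree 2, internal nodes
-- in-degree 1 / out-degree 2); a single leaf is the |X| = 1 tree.

data Tree : Set where
  leaf : ℕ → Tree
  node : Tree → Tree → Tree

leaves : Tree → List ℕ
leaves (leaf a)   = a ∷ []
leaves (node l r) = leaves l ++ leaves r

-- Binary phylogenetic X-tree: leaves bijectively labelled by X
-- (X is a duplicate-free list; the leaf label list is a permutation of X).
PhyloTree : List ℕ → Tree → Set
PhyloTree X T = leaves T ↭ X

data _⊑_ : Tree → Tree → Set where
  here  : ∀ {t} → t ⊑ t
  left  : ∀ {t l r} → t ⊑ l → t ⊑ node l r
  right : ∀ {t l r} → t ⊑ r → t ⊑ node l r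

Cherry : ℕ → ℕ → Tree → Set
Cherry x y T = (node (leaf x) (leaf y) ⊑ T) ⊎ (node (leaf y) (leaf x) ⊑ T)

-- Picking (x,y): if {x,y} is a cherry, delete leaf x and suppress the
-- parent of y, i.e. replace the cherry subtree by the leaf y; otherwise
-- the tree is unchanged.

isCherryPair : ℕ → ℕ → ℕ → ℕ → Bool
isCherryPair x y a b = (⌊ a ≟ x ⌋ ∧ ⌊ b ≟ y ⌋) ∨ (⌊ a ≟ y ⌋ ∧ ⌊ b ≟ x ⌋)

mutual
  pick : ℕ → ℕ → Tree → Tree
  pick x y (leaf a)   = leaf a
  pick x y (node l r) = pickNode x y l r

  pickNode : ℕ → ℕ → Tree → Tree → Tree
  pickNode x y (leaf a) (leaf b) =
    if isCherryPair x y a b then leaf y else node (leaf a) (leaf b)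
  pickNode x y l r = node (pick x y l) (pick x y r)

-- Cherry picking sequences: lists of entries (x,y) or (x,-).

data Entry : Set where
  pr : ℕ → ℕ → Entry
  sg : ℕ → Entry

Seq : Set
Seq = List Entry

fstE : Entry → ℕ
fstE (pr x _) = x
fstE (sg x)   = x

labelsE : Entry → List ℕ
labelsE (pr x y) = x ∷ y ∷ []
labelsE (sg x)   = x ∷ []

IsPair : Entry → Set
IsPair (pr _ _) = ⊤
IsPair (sg _)   = ⊥

IsSingle : Entry → Set
IsSingle (pr _ _) = ⊥
IsSingle (sg _)   = ⊤

-- S = <(x1,y1),...,(xr,yr),(x_{r+1},-),...,(xs,-)> : pairs first, then singles
-- (decomposition S = ps ++ ss).
Shape : Seq → List Entry → List Entry → Set
Shape S ps ss = (S ≡ ps ++ ss) × All IsPair ps × All IsSingle ss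

OverX : List ℕ → Seq → Set
OverX X S = All (λ e → All (_∈ X) (labelsE e)) S

-- partial: s = r (no singles)
Partial : Seq → Set
Partial S = All IsPair S

NotSecondIs : ℕ → Entry → Set
NotSecondIs x (pr _ y) = y ≢ x
NotSecondIs x (sg _)   = ⊤

NoLaterSecond : Seq → Set
NoLaterSecond []      = ⊤
NoLaterSecond (e ∷ S) = All (NotSecondIs (fstE e)) S × NoLaterSecond S

-- tree-child: well-shaped, s ≤ r + 1, and y_j ≠ x_i for i < j
TreeChild : Seq → Set
TreeChild S = (∃[ ps ] ∃[ ss ] (Shape S ps ss × length ss ≤ 1)) × NoLaterSecond S

apply : Seq → Tree → Tree
apply []             T = T
apply (pr x y ∷ S)   T = apply S (pick x y T)
apply (sg x ∷ S)     T = apply S T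

IsCPS : List ℕ → List Tree → Seq → Set
IsCPS X 𝒯 S =
  OverX X S ×
  (∃[ ps ] ∃[ ss ]
     (Shape S ps ss
      × ss ≢ []
      × (∀ z → (z ∈ map fstE S) ⇔ (z ∈ X))
      × All (λ T → ∃[ z ] (apply S T ≡ leaf z × z ∈ map fstE ss)) 𝒯))

IsSolution : List ℕ → List Tree → Seq → Seq → Set
IsSolution X 𝒯 S Sol = (∃[ S' ] Sol ≡ S ++ S') × IsCPS X 𝒯 Sol

IsOptimalSolution : List ℕ → List Tree → Seq → Seq → Set
IsOptimalSolution X 𝒯 S Sol =
  IsSolution X 𝒯 S Sol × (∀ Sol′ → IsSolution X 𝒯 S Sol′ → length Sol ≤ length Sol′)

-- The first entry of an optimal solution after S is a pair (x,y): since some tree of 𝒯/S still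
-- has two leaves, trailing singles alone cannot finish the sequence.  If {x,y} were a cherry of no
-- tree of 𝒯/S, picking it would change no tree, so deleting the entry leaves a shorter
-- sequence with the same effect on every tree.  It is again a cherry picking sequence: the only
-- label at risk of disappearing is x, and if x were not listed elsewhere it would never be
-- removed from any tree, so it would be the final leaf, which is listed among the singles.
module Submission where

open import Defs
open import Data.Nat using (ℕ; _<_; _≤_; _≟_)
open import Data.Nat.Properties using (1+n≰n; <-irrefl)
open import Data.Bool using (true; false; T; _∧_)
open import Data.Bool.Properties using (T-≡; T-∧; T-∨)
open import Data.List using (List; []; _∷_; _++_; [_]; length; map)
open import Data.List.Properties using (++-assoc; ∷-injective; length-++-sucʳ)
open import Data.List.Relation.Unary.All as All using (All; []; _∷_)
open import Data.List.Relation.Unary.All.Properties using (++⁻ʳ)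
open import Data.List.Relation.Unary.Any using (Any; here; there)
open import Data.List.Relation.Unary.Unique.Propositional using (Unique)
open import Data.List.Membership.Propositional using (_∈_; _∉_; find)
open import Data.List.Membership.Propositional.Properties using (∈-++⁺ˡ; ∈-++⁺ʳ; ∈-++⁻)
open import Data.List.Membership.DecPropositional _≟_ using (_∈?_)
open import Data.List.Relation.Binary.Permutation.Propositional using (↭-sym)
open import Data.List.Relation.Binary.Permutation.Propositional.Properties using (∈-resp-↭)
open import Data.Product using (_×_; ∃-syntax; _,_; proj₂)
open import Data.Sum using (_⊎_; inj₁; inj₂; [_,_]′)
import Data.Sum as Sum
open import Data.Empty using (⊥; ⊥-elim)
open import Function using (_∘_; id)
open import Function.Bundles using (mk⇔; Equivalence)
open import Relation.Nullary.Decidable using (⌊_⌋; toWitness; decidable-stable)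
open import Relation.Binary.PropositionalEquality using (_≡_; _≢_; refl; sym; trans; cong; cong₂; subst)

isCherryPair-sound : ∀ x y a b → isCherryPair x y a b ≡ true → (a ≡ x × b ≡ y) ⊎ (a ≡ y × b ≡ x)
isCherryPair-sound x y a b eq =
  Sum.map both both (Equivalence.to T-∨ (Equivalence.from T-≡ eq))
  where
  both : ∀ {c d u v} → T (⌊ c ≟ u ⌋ ∧ ⌊ d ≟ v ⌋) → c ≡ u × d ≡ v
  both {c} {u = u} t = let p , q = Equivalence.to (T-∧ {⌊ c ≟ u ⌋}) t in toWitness p , toWitness q

Cherry-left : ∀ {x y l r} → Cherry x y l → Cherry x y (node l r)
Cherry-left = Sum.map left left

Cherry-right : ∀ {x y l r} → Cherry x y r → Cherry x y (node l r)
Cherry-right = Sum.map right right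

pick-unchanged⊎Cherry : ∀ x y T → pick x y T ≡ T ⊎ Cherry x y T
pick-unchanged⊎Cherry x y (leaf a) = inj₁ refl
pick-unchanged⊎Cherry x y (node (leaf a) (leaf b)) with isCherryPair x y a b in eq
... | false = inj₁ refl
... | true with isCherryPair-sound x y a b eq
...   | inj₁ (refl , refl) = inj₂ (inj₁ here)
...   | inj₂ (refl , refl) = inj₂ (inj₂ here)
pick-unchanged⊎Cherry x y (node (leaf a) (node l r)) =
  Sum.map (cong (node (leaf a))) Cherry-right (pick-unchanged⊎Cherry x y (node l r))
pick-unchanged⊎Cherry x y (node (node l r) r′)
  with pick-unchanged⊎Cherry x y (node l r) | pick-unchanged⊎Cherry x y r′
... | inj₁ eqˡ | inj₁ eqʳ = inj₁ (cong₂ node eqˡ eqʳ)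
... | inj₂ c   | _        = inj₂ (Cherry-left c)
... | inj₁ _   | inj₂ c   = inj₂ (Cherry-right c)

∈-leaves-node : ∀ {z} l r l′ r′ → (z ∈ leaves l → z ∈ leaves l′) → (z ∈ leaves r → z ∈ leaves r′) →
                z ∈ leaves (node l r) → z ∈ leaves (node l′ r′)
∈-leaves-node l r l′ r′ f g = [ ∈-++⁺ˡ ∘ f , ∈-++⁺ʳ (leaves l′) ∘ g ]′ ∘ ∈-++⁻ (leaves l)

∈-pair⁻ : ∀ {z a b : ℕ} → z ∈ a ∷ b ∷ [] → z ≡ a ⊎ z ≡ b
∈-pair⁻ (here z≡a)         = inj₁ z≡a
∈-pair⁻ (there (here z≡b)) = inj₂ z≡b

pick-preserves-∈ : ∀ {z} x y T → z ≢ x → z ∈ leaves T → z ∈ leaves (pick x y T)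
pick-preserves-∈ x y (leaf a) _ z∈ = z∈
pick-preserves-∈ x y (node (leaf a) (leaf b)) z≢x z∈ with isCherryPair x y a b in eq
... | false = z∈
... | true with isCherryPair-sound x y a b eq | ∈-pair⁻ z∈
...   | inj₁ (refl , refl) | inj₁ refl = ⊥-elim (z≢x refl)
...   | inj₁ (refl , refl) | inj₂ refl = here refl
...   | inj₂ (refl , refl) | inj₁ refl = here refl
...   | inj₂ (refl , refl) | inj₂ refl = ⊥-elim (z≢x refl)
pick-preserves-∈ x y (node (leaf a) (node l r)) z≢x =
  ∈-leaves-node (leaf a) (node l r) (leaf a) (pick x y (node l r)) id (pick-preserves-∈ x y (node l r) z≢x)
pick-preserves-∈ x y (node (node l r) r′) z≢x =
  ∈-leaves-node (node l r) r′ (pick x y (node l r)) (pick x y r′)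
    (pick-preserves-∈ x y (node l r) z≢x) (pick-preserves-∈ x y r′ z≢x)

apply-++ : ∀ A B T → apply (A ++ B) T ≡ apply B (apply A T)
apply-++ []           B T = refl
apply-++ (pr x y ∷ A) B T = apply-++ A B (pick x y T)
apply-++ (sg x ∷ A)   B T = apply-++ A B T

apply-singles : ∀ B T → All IsSingle B → apply B T ≡ T
apply-singles []         T _        = refl
apply-singles (sg x ∷ B) T (_ ∷ ss) = apply-singles B T ss

apply-preserves-∈ : ∀ {z} Q T → z ∉ map fstE Q → z ∈ leaves T → z ∈ leaves (apply Q T)
apply-preserves-∈ []           T _  z∈ = z∈
apply-preserves-∈ (pr x y ∷ Q) T z∉ z∈ =
  apply-preserves-∈ Q (pick x y T) (z∉ ∘ there) (pick-preserves-∈ x y T (z∉ ∘ here) z∈)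
apply-preserves-∈ (sg x ∷ Q)   T z∉ z∈ = apply-preserves-∈ Q T (z∉ ∘ there) z∈

label-survives : ∀ {z w} Q T → z ∉ map fstE Q → z ∈ leaves T → apply Q T ≡ leaf w → z ≡ w
label-survives Q T z∉ z∈ final with subst (λ t → _ ∈ leaves t) final (apply-preserves-∈ Q T z∉ z∈)
... | here z≡w = z≡w

apply-skip-inert : ∀ x y A B T → pick x y (apply A T) ≡ apply A T →
                   apply (A ++ pr x y ∷ B) T ≡ apply (A ++ B) T
apply-skip-inert x y []           B T inert = cong (apply B) inert
apply-skip-inert x y (pr a b ∷ A) B T inert = apply-skip-inert x y A B (pick a b T) inert
apply-skip-inert x y (sg a ∷ A)   B T inert = apply-skip-inert x y A B T inert

All-skip : ∀ {P : Entry → Set} A {e B} → All P (A ++ e ∷ B) → All P (A ++ B)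
All-skip []      (_ ∷ pB) = pB
All-skip (a ∷ A) (pa ∷ p) = pa ∷ All-skip A p

∈-firsts-++⁺ʳ : ∀ {z} A B → z ∈ map fstE B → z ∈ map fstE (A ++ B)
∈-firsts-++⁺ʳ []      B z∈ = z∈
∈-firsts-++⁺ʳ (a ∷ A) B z∈ = there (∈-firsts-++⁺ʳ A B z∈)

∈-firsts-insert : ∀ {z} A e B → z ∈ map fstE (A ++ B) → z ∈ map fstE (A ++ e ∷ B)
∈-firsts-insert []      e B z∈          = there z∈
∈-firsts-insert (a ∷ A) e B (here z≡a)  = here z≡a
∈-firsts-insert (a ∷ A) e B (there z∈)  = there (∈-firsts-insert A e B z∈)

∈-firsts-remove : ∀ {z} A e B → z ∈ map fstE (A ++ e ∷ B) → z ≡ fstE e ⊎ z ∈ map fstE (A ++ B)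
∈-firsts-remove []      e B (here z≡e)  = inj₁ z≡e
∈-firsts-remove []      e B (there z∈)  = inj₂ z∈
∈-firsts-remove (a ∷ A) e B (here z≡a)  = inj₂ (here z≡a)
∈-firsts-remove (a ∷ A) e B (there z∈)  = Sum.map₂ there (∈-firsts-remove A e B z∈)

singles-after-single : ∀ {x ps ss} A B → Shape (A ++ sg x ∷ B) ps ss → All IsSingle (sg x ∷ B)
singles-after-single {ps = []} A B (eq , _ , singles) = ++⁻ʳ A (subst (All IsSingle) (sym eq) singles)
singles-after-single {ps = p ∷ ps} [] B (refl , () ∷ _ , _)
singles-after-single {ps = p ∷ ps} (a ∷ A) B (eq , _ ∷ pairs , singles) =
  singles-after-single A B (proj₂ (∷-injective eq) , pairs , singles)

pair-in-prefix : ∀ {x y ps ss} A B → Shape (A ++ pr x y ∷ B) ps ss →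
                 ∃[ P ] (ps ≡ A ++ pr x y ∷ P × B ≡ P ++ ss)
pair-in-prefix {ps = []} A B (eq , _ , singles) =
  ⊥-elim (All.head (++⁻ʳ A (subst (All IsSingle) (sym eq) singles)))
pair-in-prefix {ps = p ∷ ps} [] B (refl , _) = ps , refl , refl
pair-in-prefix {ps = p ∷ ps} (a ∷ A) B (eq , _ ∷ pairs , singles) with ∷-injective eq
... | refl , eq′ with pair-in-prefix A B (eq′ , pairs , singles)
...   | P , refl , B≡ = P , refl , B≡

All⊎Any : ∀ {A : Set} {P Q : A → Set} → (∀ a → P a ⊎ Q a) → ∀ xs → All P xs ⊎ Any Q xs
All⊎Any P⊎Q []       = inj₁ []
All⊎Any P⊎Q (a ∷ xs) with P⊎Q a | All⊎Any P⊎Q xs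
... | inj₁ pa | inj₁ pxs = inj₁ (pa ∷ pxs)
... | inj₁ _  | inj₂ qxs = inj₂ (there qxs)
... | inj₂ qa | _        = inj₂ (here qa)

singles-cannot-finish : ∀ {X 𝒯} S B → IsCPS X 𝒯 (S ++ B) →
                        Any (λ T → 1 < length (leaves (apply S T))) 𝒯 → All IsSingle B → ⊥
singles-cannot-finish S B (_ , _ , _ , _ , _ , _ , finish) big singles
  with find big
... | T , T∈𝒯 , twoLeaves with All.lookup finish T∈𝒯
...   | z , final , _ rewrite apply-++ S B T | apply-singles B (apply S T) singles | final =
  <-irrefl refl twoLeaves

next-entry-is-pair : ∀ {X 𝒯} S S′ → IsCPS X 𝒯 (S ++ S′) →
                     Any (λ T → 1 < length (leaves (apply S T))) 𝒯 →
                     ∃[ x ] ∃[ y ] ∃[ R ] (S′ ≡ pr x y ∷ R)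
next-entry-is-pair S [] cps big = ⊥-elim (singles-cannot-finish S [] cps big [])
next-entry-is-pair S (pr x y ∷ R) _ _ = x , y , R , refl
next-entry-is-pair S (sg x ∷ R) cps@(_ , _ , _ , shape , _) big =
  ⊥-elim (singles-cannot-finish S (sg x ∷ R) cps big (singles-after-single S R shape))

drop-inert-pair : ∀ {X 𝒯 T} x y S R → All (PhyloTree X) 𝒯 → T ∈ 𝒯 →
                  All (λ T → pick x y (apply S T) ≡ apply S T) 𝒯 →
                  IsCPS X 𝒯 (S ++ pr x y ∷ R) → IsCPS X 𝒯 (S ++ R)
drop-inert-pair {𝒯 = 𝒯} {T} x y S R phylo T∈𝒯 inert
  (over , _ , ss , shape@(_ , pairs , singles) , ss≢[] , labels , finish)
  with pair-in-prefix S R shape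
... | P , refl , refl =
  All-skip S over , S ++ P , ss , (sym (++-assoc S P ss) , All-skip S pairs , singles) , ss≢[] ,
  (λ z → mk⇔ (Equivalence.to (labels z) ∘ ∈-firsts-insert S (pr x y) R)
             ([ (λ z≡x → subst (_∈ map fstE (S ++ R)) (sym z≡x) x-listed) , id ]′
               ∘ ∈-firsts-remove S (pr x y) R ∘ Equivalence.from (labels z))) ,
  finish′
  where
  finish′ : All (λ T → ∃[ z ] (apply (S ++ R) T ≡ leaf z × z ∈ map fstE ss)) 𝒯
  finish′ = All.zipWith (λ {T} (inertT , z , final , z∈ss) →
                           z , trans (sym (apply-skip-inert x y S R T inertT)) final , z∈ss)
                        (inert , finish)

  x-listed : x ∈ map fstE (S ++ R)
  x-listed = decidable-stable (x ∈? map fstE (S ++ R)) λ x∉ →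
    let z , final , z∈ss = All.lookup finish′ T∈𝒯
        x∈T = ∈-resp-↭ (↭-sym (All.lookup phylo T∈𝒯)) (All.head (All.head (++⁻ʳ S over)))
    in x∉ (subst (_∈ map fstE (S ++ R)) (sym (label-survives (S ++ R) T x∉ x∈T final))
                 (∈-firsts-++⁺ʳ S R (∈-firsts-++⁺ʳ P ss z∈ss)))

lemma16 : (X : List ℕ) → Unique X → (𝒯 : List Tree) → All (PhyloTree X) 𝒯 →
          (S : Seq) → OverX X S → Partial S → TreeChild S →
          Any (λ T → 1 < length (leaves (apply S T))) 𝒯 →
          ∀ Sol → IsOptimalSolution X 𝒯 S Sol →
          ∃[ x ] ∃[ y ] ∃[ S″ ]
            (Sol ≡ (S ++ [ pr x y ]) ++ S″ × Any (λ T → Cherry x y (apply S T)) 𝒯)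
lemma16 X _ 𝒯 phylo S _ _ _ big _ (((S′ , refl) , cps) , optimal)
  with next-entry-is-pair S S′ cps big
... | x , y , R , refl with All⊎Any (λ T → pick-unchanged⊎Cherry x y (apply S T)) 𝒯
...   | inj₂ cherry = x , y , R , sym (++-assoc S [ pr x y ] R) , cherry
...   | inj₁ inert  = ⊥-elim (1+n≰n (subst (_≤ length (S ++ R)) (length-++-sucʳ S (pr x y) R)
                                           (optimal (S ++ R) ((R , refl) , shorter))))
  where
  shorter : IsCPS X 𝒯 (S ++ R)
  shorter = let _ , T∈𝒯 , _ = find big in drop-inert-pair x y S R phylo T∈𝒯 inert cps
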